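{- Let $\{X_i\}$ be i.i.d. with values in $\{0,1,a\}$, $P(X_1=a)=p\in(0,1)$, $P(X_1=0)=P(X_1=1)=\frac{1-p}{2}$, and let $\{Y_i\}$ be i.i.d. Bernoulli$(1/2)$, independent of $\{X_i\}$. Let $L_n$ be the length of the longest common subsequence of $X_1\ldots X_n$ and $Y_1\ldots Y_n$, and let $N^a$ be the number of $a$'s in $X_1\ldots X_n$. Let $(Z^k)_{k\ge 2}$ be generated by the bit-drop scheme described in the context, independently of $Y$ and of a random variable (also called $N^a$) having the Binomial$(n,p)$ distribution. Let $L^a_n(k)$ denote the length of the longest common subsequence of $Z^k$ and $Y_1\ldots Y_n$. Then $L_n$ has the same distribution as $L^a_n(n-N^a)$.
   Context: Bit-drop scheme: let $V_1,V_2,\ldots$ be i.i.d. Bernoulli$(1/2)$ variables and $T_3,T_4,\ldots$ independent integer variables, independent of $\{V_k\}$, with $T_{k+1}$ uniformly distributed on $\{2,\ldots,k\}$. Set $Z^2:=V_1V_2$. Given $Z^k=Z^k_1\ldots Z^k_k$, define $Z^{k+1}=Z^{k+1}_1\ldots Z^{k+1}_{k+1}$ by $Z^{k+1}_j:=Z^k_j$ for $j<T_{k+1}$, $Z^{k+1}_{T_{k+1}}:=V_{k+1}$, and $Z^{k+1}_j:=Z^k_{j-1}$ for $T_{k+1}<j\le k+1$. (So $Z^{k+1}$ is obtained from $Z^k$ by inserting the random bit $V_{k+1}$ at the random position $T_{k+1}$.)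
   Formalization: The parameter p ranges over the rationals in (0,1), and for k < 2 the word $Z^k$ is taken as empty (k = 0) or as $V_1$ (k = 1). -}

module Defs where

open import Data.Bool using (Bool; true; false; if_then_else_)
open import Data.Nat as ℕ using (ℕ; zero; suc; _∸_; _⊔_)
open import Data.Nat.Combinatorics using (_C_)
open import Data.Integer using (+_)
open import Data.Rational using (ℚ; 0ℚ; 1ℚ; ½; _+_; _*_; _-_; _/_)
open import Data.List using (List; []; _∷_; map; foldr; length; filter; concatMap; take; drop; _++_; upTo)
open import Data.Product using (_×_; _,_)
open import Relation.Binary.PropositionalEquality using (_≡_)
open import Relation.Binary.Definitions using (DecidableEquality)
open import Relation.Nullary using (yes; no)
import Data.List.Relation.Binary.Sublist.DecPropositional as SubDec

subseqs : {A : Set} → List A → List (List A)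
subseqs []       = [] ∷ []
subseqs (x ∷ xs) = subseqs xs ++ map (x ∷_) (subseqs xs)

maxℕ : List ℕ → ℕ
maxℕ = foldr _⊔_ 0

lcs : {A : Set} → DecidableEquality A → List A → List A → ℕ
lcs _≟_ xs ys =
  maxℕ (map length (filter (λ zs → zs ⊆? ys) (subseqs xs)))
  where open SubDec _≟_ using (_⊆?_)

Dist : Set → Set
Dist A = List (A × ℚ)

return : {A : Set} → A → Dist A
return a = (a , 1ℚ) ∷ []

_>>=_ : {A B : Set} → Dist A → (A → Dist B) → Dist B
d >>= f = concatMap (λ { (a , w) → map (λ { (b , v) → (b , w * v) }) (f a) }) d

infixl 1 _>>=_

probEq : Dist ℕ → ℕ → ℚ
probEq d ℓ = foldr (λ { (k , w) acc → (if k ℕ.≡ᵇ ℓ then w else 0ℚ) + acc }) 0ℚ d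

iid : {A : Set} → ℕ → Dist A → Dist (List A)
iid zero    d = return []
iid (suc n) d = d >>= λ x → iid n d >>= λ xs → return (x ∷ xs)

_^_ : ℚ → ℕ → ℚ
q ^ zero  = 1ℚ
q ^ suc k = q * (q ^ k)

bit : Dist Bool
bit = (true , ½) ∷ (false , ½) ∷ []

binomial : ℕ → ℚ → Dist ℕ
binomial n p = map (λ k → (k , ((+ (n C k) / 1) * (p ^ k)) * ((1ℚ - p) ^ (n ∸ k)))) (upTo (suc n))

data Sym : Set where
  s0 s1 sa : Sym

_≟S_ : DecidableEquality Sym
s0 ≟S s0 = yes _≡_.refl
s0 ≟S s1 = no λ ()
s0 ≟S sa = no λ ()
s1 ≟S s0 = no λ ()
s1 ≟S s1 = yes _≡_.refl
s1 ≟S sa = no λ ()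
sa ≟S s0 = no λ ()
sa ≟S s1 = no λ ()
sa ≟S sa = yes _≡_.refl

toSym : Bool → Sym
toSym false = s0
toSym true  = s1

symX : ℚ → Dist Sym
symX p = (sa , p) ∷ (s0 , (1ℚ - p) * ½) ∷ (s1 , (1ℚ - p) * ½) ∷ []

-- insert v so that it lands at (1-indexed) position t
insertAt : {A : Set} → ℕ → A → List A → List A
insertAt t v z = take (t ∸ 1) z ++ (v ∷ drop (t ∸ 1) z)

-- uniform on {2, ..., m+2}  (m+1 values)
uniform2to : (m : ℕ) → Dist ℕ
uniform2to m = map (λ i → (2 ℕ.+ i , + 1 / suc m)) (upTo (suc m))

-- law of Z^k.  Z^2 = V_1 V_2; Z^{k+1} from Z^k by inserting V_{k+1} at T_{k+1}
-- uniform on {2..k}.  Convention for k < 2: Z^0 = empty word, Z^1 = V_1.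
bitdrop : ℕ → Dist (List Bool)
bitdrop zero = return []
bitdrop (suc zero) = iid 1 bit
bitdrop (suc (suc zero)) = iid 2 bit
bitdrop (suc (suc (suc m))) =
  bitdrop (suc (suc m)) >>= λ z →
  uniform2to m >>= λ t →
  bit >>= λ v →
  return (insertAt t v z)

lawLn : ℕ → ℚ → Dist ℕ
lawLn n p =
  iid n (symX p) >>= λ x →
  iid n bit >>= λ y →
  return (lcs _≟S_ x (map toSym y))

lawLa : ℕ → ℚ → Dist ℕ
lawLa n p =
  binomial n p >>= λ N →
  bitdrop (n ∸ N) >>= λ z →
  iid n bit >>= λ y →
  return (lcs _≟S_ (map toSym z) (map toSym y))

-- A letter a never occurs in a common subsequence with a binary word, so L_n is the LCS of
-- bits X (the 0/1 letters of X) with Y. Given that X has N letters a, bits X is a uniform word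
-- of length n - N, and N is Binomial(n, p); by induction on n this comes down to Pascal's rule
-- for the binomial weights. Finally Z^k is uniform on words of length k for every k, because
-- inserting an independent fair bit at a fixed position of a uniform word gives a uniform word.
module Submission where

open import Defs
open import Data.Bool using (Bool; true; false; if_then_else_)
open import Data.Nat as ℕ using (ℕ; zero; suc; _∸_; _≡ᵇ_; _≤_; z≤n; s≤s; _<?_)
import Data.Nat.Properties as ℕ
open import Data.Nat.Combinatorics using (_C_; nCk+nC[k+1]≡[n+1]C[k+1]; k>n⇒nCk≡0)
open import Data.Nat.Coprimality using (1-coprimeTo) renaming (sym to coprime-sym)
open import Data.Integer as ℤ using (+_)
import Data.Integer.Properties as ℤ
open import Data.Rational using (ℚ; mkℚ; 0ℚ; 1ℚ; ½; _+_; _*_; _-_; _/_; _<_)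
import Data.Rational.Properties as ℚ
open import Data.Rational.Solver using (module +-*-Solver)
open import Data.List using (List; []; _∷_; map; filter; length; take; drop; _++_; applyUpTo)
import Data.List.Relation.Binary.Sublist.DecPropositional as SubDec
import Data.List.Properties as List
open import Data.List.Membership.Propositional using (_∈_)
open import Data.List.Membership.Propositional.Properties using (∈-map⁻)
open import Data.List.Relation.Unary.Any using (here; there)
import Data.List.Relation.Unary.All as All
open import Data.List.Relation.Binary.Sublist.Propositional.Properties using (Any-resp-⊆)
open import Data.Product using (_×_; _,_; proj₁; proj₂)
open import Function using (_∘_)
open import Level using (0ℓ)
open import Relation.Binary.PropositionalEquality
open import Relation.Nullary using (¬_; yes; no)
open import Relation.Unary using (Pred; Decidable)
open +-*-Solver using (solve; _:+_; _:*_; _:=_; con)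
open ≡-Reasoning

private
  variable
    A B : Set

𝔼 : Dist A → (A → ℚ) → ℚ
𝔼 []            g = 0ℚ
𝔼 ((a , w) ∷ d) g = w * g a + 𝔼 d g

indicator : ℕ → ℕ → ℚ
indicator ℓ k = if k ≡ᵇ ℓ then 1ℚ else 0ℚ

probEq≡𝔼-indicator : (d : Dist ℕ) (ℓ : ℕ) → probEq d ℓ ≡ 𝔼 d (indicator ℓ)
probEq≡𝔼-indicator []            ℓ = refl
probEq≡𝔼-indicator ((k , w) ∷ d) ℓ with k ≡ᵇ ℓ
... | true  = cong₂ _+_ (sym (ℚ.*-identityʳ w)) (probEq≡𝔼-indicator d ℓ)
... | false = cong₂ _+_ (sym (ℚ.*-zeroʳ w)) (probEq≡𝔼-indicator d ℓ)

𝔼-cong : (d : Dist A) {g h : A → ℚ} → (∀ a → g a ≡ h a) → 𝔼 d g ≡ 𝔼 d h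
𝔼-cong []            g≗h = refl
𝔼-cong ((a , w) ∷ d) g≗h = cong₂ (λ x y → w * x + y) (g≗h a) (𝔼-cong d g≗h)

𝔼-++ : (d e : Dist A) (g : A → ℚ) → 𝔼 (d ++ e) g ≡ 𝔼 d g + 𝔼 e g
𝔼-++ []            e g = sym (ℚ.+-identityˡ (𝔼 e g))
𝔼-++ ((a , w) ∷ d) e g =
  trans (cong (_+_ (w * g a)) (𝔼-++ d e g)) (sym (ℚ.+-assoc (w * g a) (𝔼 d g) (𝔼 e g)))

𝔼-zero : (d : Dist A) → 𝔼 d (λ _ → 0ℚ) ≡ 0ℚ
𝔼-zero []            = refl
𝔼-zero ((a , w) ∷ d) = cong₂ _+_ (ℚ.*-zeroʳ w) (𝔼-zero d)

𝔼-+ : (d : Dist A) (g h : A → ℚ) → 𝔼 d (λ a → g a + h a) ≡ 𝔼 d g + 𝔼 d h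
𝔼-+ []            g h = refl
𝔼-+ ((a , w) ∷ d) g h = trans (cong (_+_ (w * (g a + h a))) (𝔼-+ d g h))
  (solve 5 (λ w x y u v → w :* (x :+ y) :+ (u :+ v) := (w :* x :+ u) :+ (w :* y :+ v))
     refl w (g a) (h a) (𝔼 d g) (𝔼 d h))

𝔼-scale : (d : Dist A) (c : ℚ) (g : A → ℚ) → 𝔼 d (λ a → c * g a) ≡ c * 𝔼 d g
𝔼-scale []            c g = sym (ℚ.*-zeroʳ c)
𝔼-scale ((a , w) ∷ d) c g = trans (cong (_+_ (w * (c * g a))) (𝔼-scale d c g))
  (solve 4 (λ w c x y → w :* (c :* x) :+ c :* y := c :* (w :* x :+ y)) refl w c (g a) (𝔼 d g))

𝔼-reweight : (w : ℚ) (F : B × ℚ → B × ℚ) → (∀ b v → F (b , v) ≡ (b , w * v)) →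
  (d : Dist B) (g : B → ℚ) → 𝔼 (map F d) g ≡ w * 𝔼 d g
𝔼-reweight w F F≡ []            g = sym (ℚ.*-zeroʳ w)
𝔼-reweight w F F≡ ((b , v) ∷ d) g rewrite F≡ b v =
  trans (cong (_+_ ((w * v) * g b)) (𝔼-reweight w F F≡ d g))
    (solve 4 (λ w v x y → (w :* v) :* x :+ w :* y := w :* (v :* x :+ y)) refl w v (g b) (𝔼 d g))

𝔼->>= : (d : Dist A) (f : A → Dist B) (g : B → ℚ) → 𝔼 (d >>= f) g ≡ 𝔼 d (λ a → 𝔼 (f a) g)
𝔼->>= []            f g = refl
𝔼->>= ((a , w) ∷ d) f g = trans (𝔼-++ (map _ (f a)) (d >>= f) g)
  (cong₂ _+_ (𝔼-reweight w _ (λ b v → refl) (f a) g) (𝔼->>= d f g))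

𝔼-return : (a : A) (g : A → ℚ) → 𝔼 (return a) g ≡ g a
𝔼-return a g = trans (ℚ.+-identityʳ (1ℚ * g a)) (ℚ.*-identityˡ (g a))

𝔼-independent : {C : Set} (d : Dist A) (e : Dist B) (f : A → B → C) (g : C → ℚ) →
  𝔼 (d >>= λ a → e >>= λ b → return (f a b)) g ≡ 𝔼 d (λ a → 𝔼 e (λ b → g (f a b)))
𝔼-independent d e f g =
  trans (𝔼->>= d (λ a → e >>= λ b → return (f a b)) g) (𝔼-cong d λ a →
    trans (𝔼->>= e (λ b → return (f a b)) g) (𝔼-cong e λ b → 𝔼-return (f a b) g))

𝔼-swap : (d : Dist A) (e : Dist B) (g : A → B → ℚ) →
  𝔼 d (λ a → 𝔼 e (g a)) ≡ 𝔼 e (λ b → 𝔼 d (λ a → g a b))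
𝔼-swap []            e g = sym (𝔼-zero e)
𝔼-swap ((a , w) ∷ d) e g =
  trans (cong₂ _+_ (sym (𝔼-scale e w (g a))) (𝔼-swap d e g))
    (sym (𝔼-+ e (λ b → w * g a b) (λ b → 𝔼 d (λ a → g a b))))

𝔼-iid-suc : (n : ℕ) (d : Dist A) (g : List A → ℚ) →
  𝔼 (iid (suc n) d) g ≡ 𝔼 d (λ x → 𝔼 (iid n d) (λ xs → g (x ∷ xs)))
𝔼-iid-suc n d g = 𝔼-independent d (iid n d) _∷_ g

∑< : ℕ → (ℕ → ℚ) → ℚ
∑< zero    f = 0ℚ
∑< (suc m) f = f 0 + ∑< m (f ∘ suc)

∑<-cong : ∀ m {f g : ℕ → ℚ} → (∀ i → suc i ≤ m → f i ≡ g i) → ∑< m f ≡ ∑< m g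
∑<-cong zero    f≗g = refl
∑<-cong (suc m) f≗g = cong₂ _+_ (f≗g 0 (s≤s z≤n)) (∑<-cong m λ i i<m → f≗g (suc i) (s≤s i<m))

∑<-linear : ∀ m c d (f g : ℕ → ℚ) → ∑< m (λ i → c * f i + d * g i) ≡ c * ∑< m f + d * ∑< m g
∑<-linear zero    c d f g = solve 2 (λ c d → con 0ℚ := c :* con 0ℚ :+ d :* con 0ℚ) refl c d
∑<-linear (suc m) c d f g = trans (cong (_+_ (c * f 0 + d * g 0)) (∑<-linear m c d (f ∘ suc) (g ∘ suc)))
  (solve 6 (λ c d x y S T → (c :* x :+ d :* y) :+ (c :* S :+ d :* T) := c :* (x :+ S) :+ d :* (y :+ T))
     refl c d (f 0) (g 0) (∑< m (f ∘ suc)) (∑< m (g ∘ suc)))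

∑<-suc : ∀ m (f : ℕ → ℚ) → ∑< (suc m) f ≡ ∑< m f + f m
∑<-suc zero    f = trans (ℚ.+-identityʳ (f 0)) (sym (ℚ.+-identityˡ (f 0)))
∑<-suc (suc m) f = trans (cong (_+_ (f 0)) (∑<-suc m (f ∘ suc)))
  (sym (ℚ.+-assoc (f 0) (∑< m (f ∘ suc)) (f (suc m))))

fromℕ : ℕ → ℚ
fromℕ m = + m / 1

fromℕ≡mkℚ : ∀ m → fromℕ m ≡ mkℚ (+ m) 0 (coprime-sym (1-coprimeTo m))
fromℕ≡mkℚ m = ℚ.normalize-coprime (coprime-sym (1-coprimeTo m))

fromℕ-+ : ∀ a b → fromℕ (a ℕ.+ b) ≡ fromℕ a + fromℕ b
fromℕ-+ a b rewrite fromℕ≡mkℚ a | fromℕ≡mkℚ b =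
  ℚ./-cong {p₁ = + (a ℕ.+ b)} (sym (cong₂ ℤ._+_ (ℤ.*-identityʳ (+ a)) (ℤ.*-identityʳ (+ b)))) refl

fromℕ[1+m]*1/[1+m]≡1 : ∀ m → fromℕ (suc m) * (+ 1 / suc m) ≡ 1ℚ
fromℕ[1+m]*1/[1+m]≡1 m rewrite fromℕ≡mkℚ (suc m) | ℚ.normalize-coprime {1} {m} (1-coprimeTo (suc m)) =
  ℚ.*-inverseʳ (mkℚ (+ suc m) 0 (coprime-sym (1-coprimeTo (suc m))))

∑<-const : ∀ m c → ∑< m (λ _ → c) ≡ fromℕ m * c
∑<-const zero    c = sym (ℚ.*-zeroˡ c)
∑<-const (suc m) c = begin
  c + ∑< m (λ _ → c)  ≡⟨ cong (_+_ c) (∑<-const m c) ⟩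
  c + fromℕ m * c         ≡⟨ solve 2 (λ c x → c :+ x :* c := (con 1ℚ :+ x) :* c) refl c (fromℕ m) ⟩
  (1ℚ + fromℕ m) * c      ≡⟨ cong (_* c) (sym (fromℕ-+ 1 m)) ⟩
  fromℕ (suc m) * c       ∎

𝔼-map-applyUpTo : (Φ : ℕ → B × ℚ) (h : ℕ → ℕ) (m : ℕ) (g : B → ℚ) →
  𝔼 (map Φ (applyUpTo h m)) g ≡ ∑< m (λ i → proj₂ (Φ (h i)) * g (proj₁ (Φ (h i))))
𝔼-map-applyUpTo Φ h zero    g = refl
𝔼-map-applyUpTo Φ h (suc m) g =
  cong (_+_ (proj₂ (Φ (h 0)) * g (proj₁ (Φ (h 0))))) (𝔼-map-applyUpTo Φ (h ∘ suc) m g)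

𝔼-uniform2to-const : ∀ m (h : ℕ → ℚ) c → (∀ i → i ≤ m → h (2 ℕ.+ i) ≡ c) → 𝔼 (uniform2to m) h ≡ c
𝔼-uniform2to-const m h c h≡c = begin
  𝔼 (uniform2to m) h
    ≡⟨ 𝔼-map-applyUpTo (λ i → (2 ℕ.+ i , + 1 / suc m)) (λ i → i) (suc m) h ⟩
  ∑< (suc m) (λ i → (+ 1 / suc m) * h (2 ℕ.+ i))
    ≡⟨ ∑<-cong (suc m) (λ i i<1+m → cong (_*_ (+ 1 / suc m)) (h≡c i (ℕ.≤-pred i<1+m))) ⟩
  ∑< (suc m) (λ _ → (+ 1 / suc m) * c)       ≡⟨ ∑<-const (suc m) _ ⟩
  fromℕ (suc m) * ((+ 1 / suc m) * c)            ≡⟨ sym (ℚ.*-assoc (fromℕ (suc m)) _ c) ⟩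
  (fromℕ (suc m) * (+ 1 / suc m)) * c            ≡⟨ cong (_* c) (fromℕ[1+m]*1/[1+m]≡1 m) ⟩
  1ℚ * c                                     ≡⟨ ℚ.*-identityˡ c ⟩
  c                                          ∎

𝔼-iid-insert : ∀ k j → j ≤ k → (d : Dist A) (g : List A → ℚ) →
  𝔼 (iid k d) (λ z → 𝔼 d (λ v → g (take j z ++ v ∷ drop j z))) ≡ 𝔼 (iid (suc k) d) g
𝔼-iid-insert k       zero    _         d g =
  trans (𝔼-swap (iid k d) d (λ z v → g (v ∷ z))) (sym (𝔼-iid-suc k d g))
𝔼-iid-insert (suc k) (suc j) (s≤s j≤k) d g = begin
  𝔼 (iid (suc k) d) (λ z → 𝔼 d (λ v → g (take (suc j) z ++ v ∷ drop (suc j) z)))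
    ≡⟨ 𝔼-iid-suc k d _ ⟩
  𝔼 d (λ x → 𝔼 (iid k d) (λ z → 𝔼 d (λ v → g (x ∷ (take j z ++ v ∷ drop j z)))))
    ≡⟨ 𝔼-cong d (λ x → 𝔼-iid-insert k j j≤k d (g ∘ (x ∷_))) ⟩
  𝔼 d (λ x → 𝔼 (iid (suc k) d) (λ z → g (x ∷ z)))
    ≡⟨ sym (𝔼-iid-suc (suc k) d g) ⟩
  𝔼 (iid (suc (suc k)) d) g ∎

𝔼-bitdrop : ∀ k (g : List Bool → ℚ) → 𝔼 (bitdrop k) g ≡ 𝔼 (iid k bit) g
𝔼-bitdrop zero                g = refl
𝔼-bitdrop (suc zero)          g = refl
𝔼-bitdrop (suc (suc zero))    g = refl
𝔼-bitdrop (suc (suc (suc m))) g = begin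
  𝔼 (bitdrop (suc (suc (suc m)))) g
    ≡⟨ 𝔼->>= (bitdrop (suc (suc m))) (λ z → uniform2to m >>= λ t → bit >>= λ v → return (insertAt t v z)) g ⟩
  𝔼 (bitdrop (suc (suc m))) (λ z → 𝔼 (uniform2to m >>= λ t → bit >>= λ v → return (insertAt t v z)) g)
    ≡⟨ 𝔼-cong (bitdrop (suc (suc m))) (λ z → 𝔼-independent (uniform2to m) bit (λ t v → insertAt t v z) g) ⟩
  𝔼 (bitdrop (suc (suc m))) (λ z → 𝔼 (uniform2to m) (λ t → 𝔼 bit (λ v → g (insertAt t v z))))
    ≡⟨ 𝔼-bitdrop (suc (suc m)) _ ⟩
  𝔼 (iid (suc (suc m)) bit) (λ z → 𝔼 (uniform2to m) (λ t → 𝔼 bit (λ v → g (insertAt t v z))))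
    ≡⟨ 𝔼-swap (iid (suc (suc m)) bit) (uniform2to m) (λ z t → 𝔼 bit (λ v → g (insertAt t v z))) ⟩
  𝔼 (uniform2to m) (λ t → 𝔼 (iid (suc (suc m)) bit) (λ z → 𝔼 bit (λ v → g (insertAt t v z))))
    ≡⟨ 𝔼-uniform2to-const m _ _ (λ i i≤m → 𝔼-iid-insert (suc (suc m)) (suc i) (s≤s (ℕ.m≤n⇒m≤1+n i≤m)) bit g) ⟩
  𝔼 (iid (suc (suc (suc m))) bit) g ∎

bits : List Sym → List Bool
bits []        = []
bits (sa ∷ xs) = bits xs
bits (s0 ∷ xs) = false ∷ bits xs
bits (s1 ∷ xs) = true ∷ bits xs

filter-map : {P : Pred B 0ℓ} (P? : Decidable P) (f : A → B) (xs : List A) →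
  filter P? (map f xs) ≡ map f (filter (P? ∘ f) xs)
filter-map P? f []       = refl
filter-map P? f (x ∷ xs) with P? (f x)
... | yes _ = cong (f x ∷_) (filter-map P? f xs)
... | no  _ = filter-map P? f xs

filter-subseqs-∷ : {P : Pred (List A) 0ℓ} (P? : Decidable P) (c : A) (xs : List A) →
  filter P? (subseqs (c ∷ xs)) ≡ filter P? (subseqs xs) ++ map (c ∷_) (filter (P? ∘ (c ∷_)) (subseqs xs))
filter-subseqs-∷ P? c xs = trans (List.filter-++ P? (subseqs xs) (map (c ∷_) (subseqs xs)))
  (cong (filter P? (subseqs xs) ++_) (filter-map P? (c ∷_) (subseqs xs)))

filter-subseqs-∷-cong : {P : Pred (List A) 0ℓ} (P? : Decidable P) (c : A) (xs ys : List A) →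
  filter P? (subseqs xs) ≡ filter P? (subseqs ys) →
  filter (P? ∘ (c ∷_)) (subseqs xs) ≡ filter (P? ∘ (c ∷_)) (subseqs ys) →
  filter P? (subseqs (c ∷ xs)) ≡ filter P? (subseqs (c ∷ ys))
filter-subseqs-∷-cong P? c xs ys eq eq∷ = begin
  filter P? (subseqs (c ∷ xs))                                          ≡⟨ filter-subseqs-∷ P? c xs ⟩
  filter P? (subseqs xs) ++ map (c ∷_) (filter (P? ∘ (c ∷_)) (subseqs xs))
    ≡⟨ cong₂ (λ zss zss∷ → zss ++ map (c ∷_) zss∷) eq eq∷ ⟩
  filter P? (subseqs ys) ++ map (c ∷_) (filter (P? ∘ (c ∷_)) (subseqs ys)) ≡⟨ filter-subseqs-∷ P? c ys ⟨
  filter P? (subseqs (c ∷ ys))                                          ∎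

filter-subseqs-bits : {P : Pred (List Sym) 0ℓ} (P? : Decidable P) → (∀ {zs} → sa ∈ zs → ¬ P zs) →
  ∀ xs → filter P? (subseqs xs) ≡ filter P? (subseqs (map toSym (bits xs)))
filter-subseqs-bits P? ¬P[sa] []        = refl
filter-subseqs-bits P? ¬P[sa] (sa ∷ xs) = begin
  filter P? (subseqs (sa ∷ xs))
    ≡⟨ filter-subseqs-∷ P? sa xs ⟩
  filter P? (subseqs xs) ++ map (sa ∷_) (filter (P? ∘ (sa ∷_)) (subseqs xs))
    ≡⟨ cong (λ zss → filter P? (subseqs xs) ++ map (sa ∷_) zss)
         (List.filter-none (P? ∘ (sa ∷_)) {subseqs xs} (All.tabulate λ _ → ¬P[sa] (here refl))) ⟩
  filter P? (subseqs xs) ++ []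
    ≡⟨ List.++-identityʳ _ ⟩
  filter P? (subseqs xs)
    ≡⟨ filter-subseqs-bits P? ¬P[sa] xs ⟩
  filter P? (subseqs (map toSym (bits xs))) ∎
filter-subseqs-bits P? ¬P[sa] (s0 ∷ xs) = filter-subseqs-∷-cong P? s0 xs (map toSym (bits xs))
  (filter-subseqs-bits P? ¬P[sa] xs) (filter-subseqs-bits (P? ∘ (s0 ∷_)) (¬P[sa] ∘ there) xs)
filter-subseqs-bits P? ¬P[sa] (s1 ∷ xs) = filter-subseqs-∷-cong P? s1 xs (map toSym (bits xs))
  (filter-subseqs-bits P? ¬P[sa] xs) (filter-subseqs-bits (P? ∘ (s1 ∷_)) (¬P[sa] ∘ there) xs)

lcs-bits : ∀ xs (ys : List Bool) →
  lcs _≟S_ xs (map toSym ys) ≡ lcs _≟S_ (map toSym (bits xs)) (map toSym ys)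
lcs-bits xs ys = cong (maxℕ ∘ map length)
  (filter-subseqs-bits (_⊆? map toSym ys) sa∉common xs)
  where
  open SubDec _≟S_ using (_⊆?_; _⊆_)
  sa≢toSym : ∀ b → sa ≢ toSym b
  sa≢toSym true  ()
  sa≢toSym false ()
  sa∉common : ∀ {zs} → sa ∈ zs → ¬ zs ⊆ map toSym ys
  sa∉common sa∈zs zs⊆ys with ∈-map⁻ toSym (Any-resp-⊆ zs⊆ys sa∈zs)
  ... | b , _ , sa≡b = sa≢toSym b sa≡b

module _ (p : ℚ) where

  private
    q : ℚ
    q = 1ℚ - p

  binomialWeight : ℕ → ℕ → ℚ
  binomialWeight n k = (fromℕ (n C k) * (p ^ k)) * (q ^ (n ∸ k))

  binomialWeight-zero : ∀ n → binomialWeight (suc n) 0 ≡ q * binomialWeight n 0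
  binomialWeight-zero n =
    solve 2 (λ q Q → (con 1ℚ :* con 1ℚ) :* (q :* Q) := q :* ((con 1ℚ :* con 1ℚ) :* Q)) refl q (q ^ n)

  binomialWeight-out : ∀ {n k} → n ℕ.< k → binomialWeight n k ≡ 0ℚ
  binomialWeight-out {n} {k} n<k rewrite k>n⇒nCk≡0 n<k =
    trans (cong (_* (q ^ (n ∸ k))) (ℚ.*-zeroˡ (p ^ k))) (ℚ.*-zeroˡ (q ^ (n ∸ k)))

  binomialWeight-suc : ∀ n k →
    binomialWeight (suc n) (suc k) ≡ p * binomialWeight n k + q * binomialWeight n (suc k)
  binomialWeight-suc n k with k <? n
  ... | yes k<n = begin
    (fromℕ (suc n C suc k) * (p * p ^ k)) * q ^ (n ∸ k)
      ≡⟨ cong₂ (λ c e → (c * (p * p ^ k)) * q ^ e)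
           (trans (cong fromℕ (sym (nCk+nC[k+1]≡[n+1]C[k+1] n k))) (fromℕ-+ (n C k) (n C suc k)))
           (ℕ.+-∸-assoc 1 k<n) ⟩
    ((a + b) * (p * p ^ k)) * (q * q ^ (n ∸ suc k))
      ≡⟨ solve 6 (λ a b p P q Q → ((a :+ b) :* (p :* P)) :* (q :* Q)
                                  := p :* ((a :* P) :* (q :* Q)) :+ q :* ((b :* (p :* P)) :* Q))
           refl a b p (p ^ k) q (q ^ (n ∸ suc k)) ⟩
    p * ((a * p ^ k) * (q * q ^ (n ∸ suc k))) + q * binomialWeight n (suc k)
      ≡⟨ cong (λ e → p * ((a * p ^ k) * q ^ e) + q * binomialWeight n (suc k)) (ℕ.+-∸-assoc 1 k<n) ⟨
    p * binomialWeight n k + q * binomialWeight n (suc k) ∎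
    where
    a b : ℚ
    a = fromℕ (n C k)
    b = fromℕ (n C suc k)
  ... | no k≮n = begin
    (fromℕ (suc n C suc k) * (p * p ^ k)) * q ^ (n ∸ k)
      ≡⟨ cong (λ c → (fromℕ c * (p * p ^ k)) * q ^ (n ∸ k))
           (trans (sym (nCk+nC[k+1]≡[n+1]C[k+1] n k)) (cong (n C k ℕ.+_) (k>n⇒nCk≡0 n<1+k))) ⟩
    (fromℕ (n C k ℕ.+ 0) * (p * p ^ k)) * q ^ (n ∸ k)
      ≡⟨ cong (λ c → (fromℕ c * (p * p ^ k)) * q ^ (n ∸ k)) (ℕ.+-identityʳ (n C k)) ⟩
    (a * (p * p ^ k)) * q ^ (n ∸ k)
      ≡⟨ solve 5 (λ a p P Q q → (a :* (p :* P)) :* Q := p :* ((a :* P) :* Q) :+ q :* con 0ℚ)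
           refl a p (p ^ k) (q ^ (n ∸ k)) q ⟩
    p * binomialWeight n k + q * 0ℚ
      ≡⟨ cong (λ w → p * binomialWeight n k + q * w) (binomialWeight-out n<1+k) ⟨
    p * binomialWeight n k + q * binomialWeight n (suc k) ∎
    where
    a : ℚ
    a = fromℕ (n C k)
    n<1+k : n ℕ.< suc k
    n<1+k = s≤s (ℕ.≮⇒≥ k≮n)

  𝔼-binomial : ∀ n (H : ℕ → ℚ) → 𝔼 (binomial n p) H ≡ ∑< (suc n) (λ k → binomialWeight n k * H k)
  𝔼-binomial n H = 𝔼-map-applyUpTo (λ k → (k , binomialWeight n k)) (λ k → k) (suc n) H

  𝔼-binomial-cong : ∀ n {H H′ : ℕ → ℚ} → (∀ k → k ≤ n → H k ≡ H′ k) →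
    𝔼 (binomial n p) H ≡ 𝔼 (binomial n p) H′
  𝔼-binomial-cong n {H} {H′} H≗H′ = begin
    𝔼 (binomial n p) H                            ≡⟨ 𝔼-binomial n H ⟩
    ∑< (suc n) (λ k → binomialWeight n k * H k)
      ≡⟨ ∑<-cong (suc n) (λ k k<1+n → cong (binomialWeight n k *_) (H≗H′ k (ℕ.≤-pred k<1+n))) ⟩
    ∑< (suc n) (λ k → binomialWeight n k * H′ k)  ≡⟨ 𝔼-binomial n H′ ⟨
    𝔼 (binomial n p) H′                           ∎

  𝔼-binomial-suc : ∀ n (H : ℕ → ℚ) →
    𝔼 (binomial (suc n) p) H ≡ p * 𝔼 (binomial n p) (H ∘ suc) + q * 𝔼 (binomial n p) H
  𝔼-binomial-suc n H = begin
    𝔼 (binomial (suc n) p) H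
      ≡⟨ 𝔼-binomial (suc n) H ⟩
    w (suc n) 0 * H 0 + ∑< (suc n) (λ i → w (suc n) (suc i) * H (suc i))
      ≡⟨ cong₂ _+_ (cong (_* H 0) (binomialWeight-zero n)) (∑<-cong (suc n) λ i _ →
           trans (cong (_* H (suc i)) (binomialWeight-suc n i))
             (solve 5 (λ p a q b h → (p :* a :+ q :* b) :* h := p :* (a :* h) :+ q :* (b :* h))
                refl p (w n i) q (w n (suc i)) (H (suc i)))) ⟩
    (q * w n 0) * H 0 + ∑< (suc n) (λ i → p * (w n i * H (suc i)) + q * (w n (suc i) * H (suc i)))
      ≡⟨ cong (_+_ ((q * w n 0) * H 0))
           (∑<-linear (suc n) p q (λ i → w n i * H (suc i)) (λ i → w n (suc i) * H (suc i))) ⟩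
    (q * w n 0) * H 0 + (p * X + q * ∑< (suc n) (λ i → w n (suc i) * H (suc i)))
      ≡⟨ cong (λ z → (q * w n 0) * H 0 + (p * X + q * z))
           (trans (∑<-suc n (λ i → w n (suc i) * H (suc i)))
                  (cong (λ z → Y + z * H (suc n)) (binomialWeight-out (ℕ.n<1+n n)))) ⟩
    (q * w n 0) * H 0 + (p * X + q * (Y + 0ℚ * H (suc n)))
      ≡⟨ solve 7 (λ q w h p X Y h′ → (q :* w) :* h :+ (p :* X :+ q :* (Y :+ con 0ℚ :* h′))
                                      := p :* X :+ q :* (w :* h :+ Y))
           refl q (w n 0) (H 0) p X Y (H (suc n)) ⟩
    p * X + q * (w n 0 * H 0 + Y)
      ≡⟨ cong₂ (λ u v → p * u + q * v) (𝔼-binomial n (H ∘ suc)) (𝔼-binomial n H) ⟨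
    p * 𝔼 (binomial n p) (H ∘ suc) + q * 𝔼 (binomial n p) H ∎
    where
    w : ℕ → ℕ → ℚ
    w = binomialWeight
    X Y : ℚ
    X = ∑< (suc n) (λ i → w n i * H (suc i))
    Y = ∑< n (λ i → w n (suc i) * H (suc i))

  𝔼-symX : (f : Sym → ℚ) → 𝔼 (symX p) f ≡ p * f sa + q * 𝔼 bit (f ∘ toSym)
  𝔼-symX f = solve 6
    (λ p q h a x y → p :* a :+ ((q :* h) :* x :+ ((q :* h) :* y :+ con 0ℚ))
                     := p :* a :+ q :* (h :* y :+ (h :* x :+ con 0ℚ)))
    refl p q ½ (f sa) (f s0) (f s1)

  𝔼-bits-iid-symX : ∀ n (G : List Bool → ℚ) →
    𝔼 (iid n (symX p)) (G ∘ bits) ≡ 𝔼 (binomial n p) (λ N → 𝔼 (iid (n ∸ N) bit) G)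
  𝔼-bits-iid-symX zero    G =
    trans (𝔼-return [] (G ∘ bits)) (sym (trans (𝔼-return 0 (λ N → 𝔼 (iid (0 ∸ N) bit) G)) (𝔼-return [] G)))
  𝔼-bits-iid-symX (suc n) G = begin
    𝔼 (iid (suc n) (symX p)) (G ∘ bits)
      ≡⟨ 𝔼-iid-suc n (symX p) (G ∘ bits) ⟩
    𝔼 (symX p) (λ x → 𝔼 (iid n (symX p)) (λ xs → G (bits (x ∷ xs))))
      ≡⟨ 𝔼-symX (λ x → 𝔼 (iid n (symX p)) (λ xs → G (bits (x ∷ xs)))) ⟩
    -- 𝔼 bit unfolds into the cases b = true, false, where bits (toSym b ∷ xs) computes to b ∷ bits xs.
    p * 𝔼 (iid n (symX p)) (G ∘ bits) + q * 𝔼 bit (λ b → 𝔼 (iid n (symX p)) (λ xs → G (b ∷ bits xs)))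
      ≡⟨ cong₂ (λ u v → p * u + q * v)
           (𝔼-bits-iid-symX n G) (𝔼-cong bit λ b → 𝔼-bits-iid-symX n (G ∘ (b ∷_))) ⟩
    p * 𝔼 (binomial n p) (λ N → 𝔼 (iid (n ∸ N) bit) G)
      + q * 𝔼 bit (λ b → 𝔼 (binomial n p) (λ N → 𝔼 (iid (n ∸ N) bit) (G ∘ (b ∷_))))
      ≡⟨ cong (λ v → p * 𝔼 (binomial n p) (λ N → 𝔼 (iid (n ∸ N) bit) G) + q * v)
           (trans (𝔼-swap bit (binomial n p) (λ b N → 𝔼 (iid (n ∸ N) bit) (G ∘ (b ∷_))))
                  (𝔼-binomial-cong n λ N N≤n → sym (𝔼-iid-bit-∸ N≤n))) ⟩
    p * 𝔼 (binomial n p) (λ N → 𝔼 (iid (n ∸ N) bit) G)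
      + q * 𝔼 (binomial n p) (λ N → 𝔼 (iid (suc n ∸ N) bit) G)
      ≡⟨ 𝔼-binomial-suc n (λ N → 𝔼 (iid (suc n ∸ N) bit) G) ⟨
    𝔼 (binomial (suc n) p) (λ N → 𝔼 (iid (suc n ∸ N) bit) G) ∎
    where
    𝔼-iid-bit-∸ : ∀ {N} → N ≤ n →
      𝔼 (iid (suc n ∸ N) bit) G ≡ 𝔼 bit (λ b → 𝔼 (iid (n ∸ N) bit) (G ∘ (b ∷_)))
    𝔼-iid-bit-∸ {N} N≤n =
      trans (cong (λ m → 𝔼 (iid m bit) G) (ℕ.+-∸-assoc 1 N≤n)) (𝔼-iid-suc (n ∸ N) bit G)

-- The identity is polynomial in p.
lemma3p1 : (n : ℕ) (p : ℚ) → 0ℚ < p → p < 1ℚ →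
    (ℓ : ℕ) → probEq (lawLn n p) ℓ ≡ probEq (lawLa n p) ℓ
lemma3p1 n p _ _ ℓ = begin
  probEq (lawLn n p) ℓ
    ≡⟨ probEq≡𝔼-indicator (lawLn n p) ℓ ⟩
  𝔼 (lawLn n p) (indicator ℓ)
    ≡⟨ 𝔼-independent (iid n (symX p)) (iid n bit) (λ x y → lcs _≟S_ x (map toSym y)) (indicator ℓ) ⟩
  𝔼 (iid n (symX p)) (λ x → 𝔼 (iid n bit) (λ y → indicator ℓ (lcs _≟S_ x (map toSym y))))
    ≡⟨ 𝔼-cong (iid n (symX p)) (λ x → 𝔼-cong (iid n bit) λ y → cong (indicator ℓ) (lcs-bits x y)) ⟩
  𝔼 (iid n (symX p)) (G ∘ bits)
    ≡⟨ 𝔼-bits-iid-symX p n G ⟩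
  𝔼 (binomial n p) (λ N → 𝔼 (iid (n ∸ N) bit) G)
    ≡⟨ 𝔼-cong (binomial n p) (λ N → 𝔼-bitdrop (n ∸ N) G) ⟨
  𝔼 (binomial n p) (λ N → 𝔼 (bitdrop (n ∸ N)) G)
    ≡⟨ 𝔼-cong (binomial n p) (λ N → 𝔼-independent (bitdrop (n ∸ N)) (iid n bit) lcs₂ (indicator ℓ)) ⟨
  𝔼 (binomial n p) (λ N → 𝔼 (bitdrop (n ∸ N) >>= λ z → iid n bit >>= λ y → return (lcs₂ z y)) (indicator ℓ))
    ≡⟨ 𝔼->>= (binomial n p) (λ N → bitdrop (n ∸ N) >>= λ z → iid n bit >>= λ y → return (lcs₂ z y))
             (indicator ℓ) ⟨
  𝔼 (lawLa n p) (indicator ℓ)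
    ≡⟨ probEq≡𝔼-indicator (lawLa n p) ℓ ⟨
  probEq (lawLa n p) ℓ ∎
  where
  lcs₂ : List Bool → List Bool → ℕ
  lcs₂ z y = lcs _≟S_ (map toSym z) (map toSym y)
  G : List Bool → ℚ
  G z = 𝔼 (iid n bit) (λ y → indicator ℓ (lcs₂ z y))
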